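{- Let $G$ be a graph, $f:V(G)\to\mathbb{Z}$, and $v\in V(G)$ with $f(v)=0$. Then $G$ is weakly $f$-degenerate if and only if $G-v$ is weakly $f_{ -v}$-degenerate.
   Context: For $g:V(G)\to\mathbb{Z}$ and $U\subseteq V(G)$, $g_{ -U}(x)=g(x)-|N_G(x)\cap U|$ for $x\in V(G)\setminus U$; $g_{ -v}=g_{ -\{v\}}$; $\delta_w$ is the indicator function of $w$. Operations: $\mathsf{Delete}(u)(G,g)=(G-u,g_{ -u})$, legal if $g$ and $g_{ -u}$ are non-negative; $\mathsf{DeleteSave}(u,w)(G,g)=(G-u,g_{ -u}+\delta_w)$, legal if $uw\in E(G)$, $g(u)>g(w)$, and $g$ and $g_{ -u}+\delta_w$ are non-negative. $G$ is weakly $g$-degenerate if some sequence of operations, each legal for the pair produced by the previous ones starting from $(G,g)$, removes all vertices of $G$. -}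

module Defs where

open import Data.Nat using (ℕ)
open import Data.Bool using (Bool; true; false; if_then_else_; _∧_; not)
open import Data.Fin using (Fin; _≟_)
open import Data.Integer using (ℤ; _-_; _+_; _≤_; _<_; 0ℤ; 1ℤ)
open import Relation.Nullary.Decidable using (⌊_⌋)
open import Relation.Binary.PropositionalEquality using (_≡_)

record Graph (n : ℕ) : Set where
  field
    adj      : Fin n → Fin n → Bool
    adj-sym  : ∀ x y → adj x y ≡ adj y x
    adj-irr  : ∀ x → adj x x ≡ false
open Graph public

-- A vertex subset U ⊆ Fin n (used for induced subgraphs G[U]).
VSet : ℕ → Set
VSet n = Fin n → Bool

full : ∀ {n} → VSet n
full _ = true

remove : ∀ {n} → VSet n → Fin n → VSet n
remove U u x = U x ∧ not ⌊ x ≟ u ⌋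

nbr : ∀ {n} → Graph n → Fin n → Fin n → ℤ
nbr G u x = if adj G x u then 1ℤ else 0ℤ

-- g_{-u}(x) = g(x) - |N(x) ∩ {u}|   (only meaningful for x ≠ u)
minus : ∀ {n} → Graph n → (Fin n → ℤ) → Fin n → (Fin n → ℤ)
minus G g u x = g x - nbr G u x

δ : ∀ {n} → Fin n → Fin n → ℤ
δ w x = if ⌊ x ≟ w ⌋ then 1ℤ else 0ℤ

NonNeg : ∀ {n} → VSet n → (Fin n → ℤ) → Set
NonNeg U g = ∀ x → U x ≡ true → 0ℤ ≤ g x

-- WeaklyDeg G U g : the induced subgraph G[U] is weakly g-degenerate,
-- i.e. some sequence of legal Delete / DeleteSave operations, starting
-- from (G[U], g), removes all vertices.
data WeaklyDeg {n : ℕ} (G : Graph n) : VSet n → (Fin n → ℤ) → Set where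
  done   : ∀ {U g} → (∀ x → U x ≡ false) → WeaklyDeg G U g
  delete : ∀ {U g} (u : Fin n) → U u ≡ true →
           NonNeg U g → NonNeg (remove U u) (minus G g u) →
           WeaklyDeg G (remove U u) (minus G g u) →
           WeaklyDeg G U g
  deleteSave : ∀ {U g} (u w : Fin n) → U u ≡ true → U w ≡ true →
           adj G u w ≡ true → g w < g u →
           NonNeg U g →
           NonNeg (remove U u) (λ x → minus G g u x + δ w x) →
           WeaklyDeg G (remove U u) (λ x → minus G g u x + δ w x) →
           WeaklyDeg G U g

module Submission where

-- Induction on a deletion sequence for (G, f) with f(v) = 0.  Since f(v) = 0 and
-- values stay non-negative, no earlier step can delete a neighbour u of v
-- plainly, and DeleteSave(v, w) is impossible (f(w) < 0).  So every step before
-- v's own deletion either ignores v or is DeleteSave(u, v), which restores v's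
-- value to 0; such steps commute with deleting v first, the latter becoming a
-- plain Delete(u).  Conversely Delete(v) is always legal as a first step.

open import Defs
open import Data.Nat using (ℕ; z≤n)
open import Data.Fin using (Fin; _≟_)
open import Data.Integer using (ℤ; 0ℤ; 1ℤ; _+_; _-_; _≤_; _<_; +[1+_]; +≤+; +<+)
open import Data.Integer.Properties using (i-j≤i; +-identityʳ; ≤-trans; ≤-<-trans; <-irrefl; ≤-reflexive)
open import Data.Integer.Tactic.RingSolver using (solve-∀)
open import Data.Bool using (true; false; _∧_; not)
open import Data.Bool.Properties using (∧-assoc; ∧-comm; ∧-identityʳ; ∧-zeroʳ)
open import Data.Product using (_×_; _,_)
open import Data.Empty using (⊥-elim)
open import Relation.Nullary using (¬_; yes; no)
open import Relation.Nullary.Decidable using (⌊_⌋)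
open import Relation.Binary.PropositionalEquality

0<i⇒0≤i-1 : ∀ {i} → 0ℤ < i → 0ℤ ≤ i - 1ℤ
0<i⇒0≤i-1 {+[1+ _ ]} (+<+ _) = +≤+ z≤n

i-1+1≡i : ∀ i → i - 1ℤ + 1ℤ ≡ i
i-1+1≡i = solve-∀

i-j-k≡i-k-j : ∀ i j k → i - j - k ≡ i - k - j
i-j-k≡i-k-j = solve-∀

i-j+l-k≡i-k-j+l : ∀ i j k l → i - j + l - k ≡ i - k - j + l
i-j+l-k≡i-k-j+l = solve-∀

module _ {n : ℕ} where

  _≐_ : VSet n → VSet n → Set
  U ≐ U′ = ∀ x → U x ≡ U′ x

  remove-⊆ : ∀ (U : VSet n) u {x} → remove U u x ≡ true → U x ≡ true
  remove-⊆ U u {x} h with U x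
  ... | true  = refl
  ... | false = h

  remove-≢ : ∀ (U : VSet n) u {x} → remove U u x ≡ true → ¬ x ≡ u
  remove-≢ U u {x} h refl with x ≟ x
  ... | yes _  with () ← trans (sym (∧-zeroʳ (U x))) h
  ... | no x≢x = x≢x refl

  remove-keeps : ∀ (U : VSet n) {u x} → ¬ x ≡ u → U x ≡ true → remove U u x ≡ true
  remove-keeps U {u} {x} x≢u Ux with x ≟ u
  ... | yes x≡u = ⊥-elim (x≢u x≡u)
  ... | no _    = trans (∧-identityʳ (U x)) Ux

  remove-comm : ∀ (U : VSet n) u v → remove (remove U u) v ≐ remove (remove U v) u
  remove-comm U u v x = begin
    (U x ∧ x≠u) ∧ x≠v  ≡⟨ ∧-assoc (U x) x≠u x≠v ⟩
    U x ∧ (x≠u ∧ x≠v)  ≡⟨ cong (U x ∧_) (∧-comm x≠u x≠v) ⟩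
    U x ∧ (x≠v ∧ x≠u)  ≡⟨ ∧-assoc (U x) x≠v x≠u ⟨
    (U x ∧ x≠v) ∧ x≠u  ∎
    where
    open ≡-Reasoning
    x≠u = not ⌊ x ≟ u ⌋
    x≠v = not ⌊ x ≟ v ⌋

  remove-resp-≐ : ∀ {U U′ : VSet n} u → U ≐ U′ → remove U u ≐ remove U′ u
  remove-resp-≐ u U≐U′ x = cong (_∧ _) (U≐U′ x)

  δ-≢ : ∀ {w x : Fin n} → ¬ x ≡ w → δ w x ≡ 0ℤ
  δ-≢ {w} {x} x≢w with x ≟ w
  ... | yes x≡w = ⊥-elim (x≢w x≡w)
  ... | no _    = refl

  +δ-≢ : ∀ {w x : Fin n} i → ¬ x ≡ w → i + δ w x ≡ i
  +δ-≢ i x≢w = trans (cong (i +_) (δ-≢ x≢w)) (+-identityʳ i)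

  δ-self : ∀ (w : Fin n) → δ w w ≡ 1ℤ
  δ-self w with w ≟ w
  ... | yes _  = refl
  ... | no w≢w = ⊥-elim (w≢w refl)

  nonNeg-unremove : ∀ {U u g g′} → NonNeg (remove U u) g′ → (∀ x → g′ x ≤ g x) →
                    0ℤ ≤ g u → NonNeg U g
  nonNeg-unremove {U} {u} nn g′≤g 0≤gu x Ux with x ≟ u
  ... | yes refl = 0≤gu
  ... | no x≢u   = ≤-trans (nn x (remove-keeps U x≢u Ux)) (g′≤g x)

  nonNeg-resp : ∀ {U U′ g g′} → U ≐ U′ → (∀ x → U x ≡ true → g x ≡ g′ x) →
                NonNeg U g → NonNeg U′ g′
  nonNeg-resp U≐U′ g≐g′ nn x U′x = subst (0ℤ ≤_) (g≐g′ x Ux) (nn x Ux)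
    where Ux = trans (U≐U′ x) U′x

module _ {n : ℕ} (G : Graph n) where

  minus-nonadj : ∀ g {u x} → adj G x u ≡ false → minus G g u x ≡ g x
  minus-nonadj g {u} {x} ¬xu rewrite ¬xu = +-identityʳ (g x)

  minus-adj : ∀ g {u x} → adj G x u ≡ true → minus G g u x ≡ g x - 1ℤ
  minus-adj g {u} {x} xu rewrite xu = refl

  minus-≤ : ∀ g u x → minus G g u x ≤ g x
  minus-≤ g u x with adj G x u
  ... | true  = i-j≤i (g x) 1ℤ
  ... | false = i-j≤i (g x) 0ℤ

  save-≤ : ∀ g {u w} → adj G u w ≡ true → ∀ x → minus G g u x + δ w x ≤ g x
  save-≤ g {u} {w} uw x with x ≟ w
  ... | no _     = ≤-trans (≤-reflexive (+-identityʳ _)) (minus-≤ g u x)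
  ... | yes refl = ≤-reflexive (trans (cong (λ t → t + 1ℤ) (minus-adj g (trans (adj-sym G x u) uw)))
                                      (i-1+1≡i (g x)))

  minus-comm : ∀ g u v x → minus G (minus G g u) v x ≡ minus G (minus G g v) u x
  minus-comm g u v x = i-j-k≡i-k-j (g x) (nbr G u x) (nbr G v x)

  minus-save-comm : ∀ g u v w x →
    minus G (λ y → minus G g u y + δ w y) v x ≡ minus G (minus G g v) u x + δ w x
  minus-save-comm g u v w x = i-j+l-k≡i-k-j+l (g x) (nbr G u x) (nbr G v x) (δ w x)

  zero-nonadjacent : ∀ g {u v} → g v ≡ 0ℤ → 0ℤ ≤ minus G g u v → adj G v u ≡ false
  zero-nonadjacent g {u} {v} gv≡0 0≤ with adj G v u
  ... | false = refl
  ... | true  with () ← subst (λ t → 0ℤ ≤ t - 1ℤ) gv≡0 0≤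

  WeaklyDeg⇒NonNeg : ∀ {U g} → WeaklyDeg G U g → NonNeg U g
  WeaklyDeg⇒NonNeg (done empty) x Ux with () ← trans (sym (empty x)) Ux
  WeaklyDeg⇒NonNeg (delete _ _ nn _ _)              = nn
  WeaklyDeg⇒NonNeg (deleteSave _ _ _ _ _ _ nn _ _) = nn

  WeaklyDeg-resp : ∀ {U U′ g g′} → U ≐ U′ → (∀ x → U x ≡ true → g x ≡ g′ x) →
                   WeaklyDeg G U g → WeaklyDeg G U′ g′
  WeaklyDeg-resp U≐U′ _ (done empty) = done (λ x → trans (sym (U≐U′ x)) (empty x))
  WeaklyDeg-resp {U} {U′} {g} {g′} U≐U′ g≐g′ (delete u Uu nn nn′ wd) =
    delete u (trans (sym (U≐U′ u)) Uu) (nonNeg-resp U≐U′ g≐g′ nn)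
      (nonNeg-resp U-u≐U′-u g-u≐g′-u nn′) (WeaklyDeg-resp U-u≐U′-u g-u≐g′-u wd)
    where
    U-u≐U′-u : remove U u ≐ remove U′ u
    U-u≐U′-u = remove-resp-≐ u U≐U′
    g-u≐g′-u : ∀ x → remove U u x ≡ true → minus G g u x ≡ minus G g′ u x
    g-u≐g′-u x h = cong (_- nbr G u x) (g≐g′ x (remove-⊆ U u h))
  WeaklyDeg-resp {U} {U′} {g} {g′} U≐U′ g≐g′ (deleteSave u w Uu Uw uw gw<gu nn nn′ wd) =
    deleteSave u w (trans (sym (U≐U′ u)) Uu) (trans (sym (U≐U′ w)) Uw) uw
      (subst₂ _<_ (g≐g′ w Uw) (g≐g′ u Uu) gw<gu) (nonNeg-resp U≐U′ g≐g′ nn)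
      (nonNeg-resp U-u≐U′-u g-u≐g′-u nn′) (WeaklyDeg-resp U-u≐U′-u g-u≐g′-u wd)
    where
    U-u≐U′-u : remove U u ≐ remove U′ u
    U-u≐U′-u = remove-resp-≐ u U≐U′
    g-u≐g′-u : ∀ x → remove U u x ≡ true → minus G g u x + δ w x ≡ minus G g′ u x + δ w x
    g-u≐g′-u x h = cong (λ t → t - nbr G u x + δ w x) (g≐g′ x (remove-⊆ U u h))

  delete′ : ∀ {U g} u → U u ≡ true → 0ℤ ≤ g u →
            WeaklyDeg G (remove U u) (minus G g u) → WeaklyDeg G U g
  delete′ {U} {g} u Uu 0≤gu wd =
    delete u Uu (nonNeg-unremove nn (minus-≤ g u) 0≤gu) nn wd
    where
    nn : NonNeg (remove U u) (minus G g u)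
    nn = WeaklyDeg⇒NonNeg wd

  deleteSave′ : ∀ {U g} u w → U u ≡ true → U w ≡ true → adj G u w ≡ true →
                g w < g u → 0ℤ ≤ g u →
                WeaklyDeg G (remove U u) (λ x → minus G g u x + δ w x) → WeaklyDeg G U g
  deleteSave′ {U} {g} u w Uu Uw uw gw<gu 0≤gu wd =
    deleteSave u w Uu Uw uw gw<gu (nonNeg-unremove nn (save-≤ g uw) 0≤gu) nn wd
    where
    nn : NonNeg (remove U u) (λ x → minus G g u x + δ w x)
    nn = WeaklyDeg⇒NonNeg wd

  WeaklyDeg-remove-zero : ∀ {U g v} → U v ≡ true → g v ≡ 0ℤ → WeaklyDeg G U g →
                          WeaklyDeg G (remove U v) (minus G g v)
  WeaklyDeg-remove-zero {v = v} Uv _ (done empty) with () ← trans (sym (empty v)) Uv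
  WeaklyDeg-remove-zero {U} {g} {v} Uv gv≡0 (delete u Uu nn nn′ wd) with u ≟ v
  ... | yes refl = wd
  ... | no u≢v = delete′ u (remove-keeps U u≢v Uu) 0≤gu-v wd′
    where
    U-u∋v : remove U u v ≡ true
    U-u∋v = remove-keeps U (≢-sym u≢v) Uv
    v∉Nu : adj G v u ≡ false
    v∉Nu = zero-nonadjacent g gv≡0 (nn′ v U-u∋v)
    0≤gu-v : 0ℤ ≤ minus G g v u
    0≤gu-v = subst (0ℤ ≤_) (sym (minus-nonadj g (trans (adj-sym G u v) v∉Nu))) (nn u Uu)
    wd′ : WeaklyDeg G (remove (remove U v) u) (minus G (minus G g v) u)
    wd′ = WeaklyDeg-resp (remove-comm U u v) (λ x _ → minus-comm g u v x)
            (WeaklyDeg-remove-zero U-u∋v (trans (minus-nonadj g v∉Nu) gv≡0) wd)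
  WeaklyDeg-remove-zero {U} {g} {v} Uv gv≡0 (deleteSave u w Uu Uw uw gw<gu nn nn′ wd)
    with u ≟ v | w ≟ v
  ... | yes refl | _ = ⊥-elim (<-irrefl refl (≤-<-trans (nn w Uw) (subst (g w <_) gv≡0 gw<gu)))
  ... | no u≢v | yes refl = delete′ u (remove-keeps U u≢v Uu) 0≤gu-v wd′
    where
    U-u∋v : remove U u w ≡ true
    U-u∋v = remove-keeps U (≢-sym u≢v) Uv
    0≤gu-v : 0ℤ ≤ minus G g w u
    0≤gu-v = subst (0ℤ ≤_) (sym (minus-adj g uw)) (0<i⇒0≤i-1 (subst (_< g u) gv≡0 gw<gu))
    saved : minus G g u w + δ w w ≡ 0ℤ
    saved = begin
      minus G g u w + δ w w  ≡⟨ cong₂ _+_ (minus-adj g (trans (adj-sym G w u) uw)) (δ-self w) ⟩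
      g w - 1ℤ + 1ℤ          ≡⟨ i-1+1≡i (g w) ⟩
      g w                    ≡⟨ gv≡0 ⟩
      0ℤ                     ∎
      where open ≡-Reasoning
    -- Matching w ≟ v against refl has renamed v to w in this clause.
    agree : ∀ x → remove (remove U u) w x ≡ true →
            minus G (λ y → minus G g u y + δ w y) w x ≡ minus G (minus G g w) u x
    agree x h = trans (minus-save-comm g u w w x) (+δ-≢ _ (remove-≢ (remove U u) w h))
    wd′ : WeaklyDeg G (remove (remove U w) u) (minus G (minus G g w) u)
    wd′ = WeaklyDeg-resp (remove-comm U u w) agree (WeaklyDeg-remove-zero U-u∋v saved wd)
  ... | no u≢v | no w≢v =
    deleteSave′ u w (remove-keeps U u≢v Uu) (remove-keeps U w≢v Uw) uw gw<gu-v 0≤gu-v wd′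
    where
    U-u∋v : remove U u v ≡ true
    U-u∋v = remove-keeps U (≢-sym u≢v) Uv
    gu-v≡gu+δ : minus G g u v + δ w v ≡ minus G g u v
    gu-v≡gu+δ = +δ-≢ (minus G g u v) (≢-sym w≢v)
    v∉Nu : adj G v u ≡ false
    v∉Nu = zero-nonadjacent g gv≡0 (subst (0ℤ ≤_) gu-v≡gu+δ (nn′ v U-u∋v))
    gu-v≡gu : minus G g v u ≡ g u
    gu-v≡gu = minus-nonadj g (trans (adj-sym G u v) v∉Nu)
    0≤gu-v : 0ℤ ≤ minus G g v u
    0≤gu-v = subst (0ℤ ≤_) (sym gu-v≡gu) (nn u Uu)
    gw<gu-v : minus G g v w < minus G g v u
    gw<gu-v = ≤-<-trans (minus-≤ g v w) (subst (g w <_) (sym gu-v≡gu) gw<gu)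
    wd′ : WeaklyDeg G (remove (remove U v) u) (λ x → minus G (minus G g v) u x + δ w x)
    wd′ = WeaklyDeg-resp (remove-comm U u v) (λ x _ → minus-save-comm g u v w x)
            (WeaklyDeg-remove-zero U-u∋v
              (trans gu-v≡gu+δ (trans (minus-nonadj g v∉Nu) gv≡0)) wd)

proposition2 : ∀ {n : ℕ} (G : Graph n) (f : Fin n → ℤ) (v : Fin n) → f v ≡ 0ℤ →
    (WeaklyDeg G full f → WeaklyDeg G (remove full v) (minus G f v)) ×
    (WeaklyDeg G (remove full v) (minus G f v) → WeaklyDeg G full f)
proposition2 G f v fv≡0 =
  WeaklyDeg-remove-zero G refl fv≡0 , delete′ G v refl (≤-reflexive (sym fv≡0))
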